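{- For all positive integers $n$ and $r$ with $1\le r\le n-2$, $$\sum_{\pi\in\mathcal{A}_n^r}t^{\mathsf{exc}(\pi)}s^{\mathsf{nexc}(\pi)-1}=\sum_{\pi\in\mathfrak{S}_n^r\setminus\mathcal{A}_n^r}t^{\mathsf{exc}(\pi)}s^{\mathsf{nexc}(\pi)-1}=\frac12\sum_{\pi\in\mathfrak{S}_n^r}t^{\mathsf{exc}(\pi)}s^{\mathsf{nexc}(\pi)-1}.$$
   Context: $\mathfrak{S}_n$ is the symmetric group on $[n]$ and $\mathcal{A}_n$ its even permutations. $\mathfrak{S}_n^r=\{\pi\in\mathfrak{S}_n:\pi_r=n\}$ and $\mathcal{A}_n^r=\mathfrak{S}_n^r\cap\mathcal{A}_n$. $\mathsf{exc}(\pi)=|\{i:\pi_i>i\}|$, $\mathsf{nexc}(\pi)=|\{i:\pi_i\le i\}|$. -}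

module Defs where

open import Data.Nat using (ℕ; zero; suc; _+_; _*_; _∸_; _<ᵇ_; _≡ᵇ_)
open import Data.Bool using (Bool; true; false; _∧_; _∨_; not; if_then_else_)
open import Data.Fin using (Fin; toℕ)
open import Data.Vec using (Vec; []; _∷_; lookup)
open import Data.List using (List; []; _∷_; [_]; map; concatMap; filter; length; allFin)
open import Data.List.Base using (all)
open import Data.Nat.ListAction using (sum)
open import Function using (_∘_)
open import Relation.Binary.PropositionalEquality using (_≡_)
open import Relation.Nullary.Decidable using (does)
open import Data.Bool.Properties using (_≟_)

-- Convention: [n] = {1..n} is encoded by Fin n, position/value i+1 ↦ i : Fin n.
-- A permutation π of [n] is a vector of length n (π_i = lookup π i) with
-- pairwise distinct entries.

words : (n m : ℕ) → List (Vec (Fin n) m)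
words n zero    = [ [] ]
words n (suc m) = concatMap (λ w → map (_∷ w) (allFin n)) (words n m)

isPerm : {n : ℕ} → Vec (Fin n) n → Bool
isPerm {n} π = all (λ i → all (λ j → (toℕ i ≡ᵇ toℕ j) ∨ not (toℕ (lookup π i) ≡ᵇ toℕ (lookup π j))) (allFin n)) (allFin n)

Sym : (n : ℕ) → List (Vec (Fin n) n)
Sym n = filter (λ π → true ≟ isPerm π) (words n n)

countB : {A : Set} → (A → Bool) → List A → ℕ
countB p xs = length (filter (λ x → true ≟ p x) xs)

exc : {n : ℕ} → Vec (Fin n) n → ℕ
exc {n} π = countB (λ i → toℕ i <ᵇ toℕ (lookup π i)) (allFin n)

nexc : {n : ℕ} → Vec (Fin n) n → ℕ
nexc {n} π = countB (λ i → not (toℕ i <ᵇ toℕ (lookup π i))) (allFin n)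

inv : {n : ℕ} → Vec (Fin n) n → ℕ
inv {n} π = sum (map (λ i → countB (λ j → (toℕ i <ᵇ toℕ j) ∧ (toℕ (lookup π j) <ᵇ toℕ (lookup π i))) (allFin n)) (allFin n))

isEvenℕ : ℕ → Bool
isEvenℕ zero          = true
isEvenℕ (suc zero)    = false
isEvenℕ (suc (suc k)) = isEvenℕ k

isEven : {n : ℕ} → Vec (Fin n) n → Bool
isEven π = isEvenℕ (inv π)

-- π_r = n  (1-indexed r, with r ≥ 1)
hasMaxAt : {n : ℕ} → (r : ℕ) → Vec (Fin n) n → Bool
hasMaxAt {n} r π = all (λ i → not (suc (toℕ i) ≡ᵇ r) ∨ (suc (toℕ (lookup π i)) ≡ᵇ n)) (allFin n)
                   ∧ (1 ≤ᵇ' r) ∧ (r ≤ᵇ' n)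
  where
  _≤ᵇ'_ : ℕ → ℕ → Bool
  a ≤ᵇ' b = a <ᵇ suc b

Sr : (n r : ℕ) → List (Vec (Fin n) n)
Sr n r = filter (λ π → true ≟ hasMaxAt r π) (Sym n)

Ar : (n r : ℕ) → List (Vec (Fin n) n)
Ar n r = filter (λ π → true ≟ isEven π) (Sr n r)

SrMinusAr : (n r : ℕ) → List (Vec (Fin n) n)
SrMinusAr n r = filter (λ π → true ≟ not (isEven π)) (Sr n r)

-- A polynomial in ℕ[t,s] is represented by its coefficient function:
-- P a b = coefficient of t^a s^b.
Poly : Set
Poly = ℕ → ℕ → ℕ

genPoly : {n : ℕ} → List (Vec (Fin n) n) → Poly
genPoly X a b = countB (λ π → (exc π ≡ᵇ a) ∧ ((nexc π ∸ 1) ≡ᵇ b)) X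

_≈P_ : Poly → Poly → Set
P ≈P Q = ∀ a b → P a b ≡ Q a b

-- scalar multiple 2·P (used to express P = ½ Q as 2·P = Q)
twice : Poly → Poly
twice P a b = 2 * P a b

module Submission where

-- Write n = k + 2, so the hypothesis reads 1 ≤ r ≤ k.  For
-- π ∈ 𝔖ₙʳ the maximum n sits at position r < n - 1, so by injectivity the
-- values at the last two positions n - 1 and n are at most n - 1: neither
-- position is an excedance, before or after exchanging these two values.
-- Hence π ↦ π ∘ (n-1 n) is an involution of 𝔖ₙʳ preserving exc and nexc,
-- and it changes the number of inversions by one, so it flips parity.  It
-- is therefore a statistic-preserving bijection 𝒜ₙʳ → 𝔖ₙʳ ∖ 𝒜ₙʳ (first
-- identity), and the second identity follows because 𝔖ₙʳ is the disjoint
-- union of these two sets.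

open import Defs
open import Data.Nat using (ℕ; _≤_; _∸_)
open import Data.Product using (_×_)
open import Data.Product using (_,_; proj₁; proj₂)
open import Data.Nat using (zero; suc; _+_; _*_; _<ᵇ_; _≡ᵇ_; _<_; z≤n; s≤s; s≤s⁻¹; _<?_)
open import Data.Nat.Properties
  using (+-0-commutativeMonoid; +-suc; +-identityʳ; suc-injective; ≡ᵇ⇒≡; ≡⇒≡ᵇ;
         <⇒≱; ≮⇒≥; ≤∧≢⇒<; ≤-trans; ≤-reflexive; n≤1+n)
open import Data.Bool using (Bool; true; false; _∧_; _∨_; not; if_then_else_; T)
open import Data.Bool.Properties using (_≟_; ∧-commutativeMonoid; T-≡; T-∧)
open import Data.Unit using (tt)
open import Data.Fin using (Fin; toℕ; zero; suc; fromℕ<)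
open import Data.Fin.Properties using (toℕ<n; toℕ-fromℕ<; toℕ-injective; 0≢1+n)
  renaming (suc-injective to Fin-suc-injective)
import Data.Fin as Fin
open import Data.Fin.Permutation using (permutation)
open import Data.Vec using (Vec; []; _∷_; lookup)
import Data.Vec.Functional as Vector
open import Data.List as List using (List; []; _∷_; map; filter; allFin; concatMap)
open import Data.Bool.ListAction using (and; all)
open import Data.List.Properties using (map-++; map-cong; map-tabulate)
open import Data.Nat.ListAction using (sum)
open import Data.Nat.ListAction.Properties using (sum-++)
open import Algebra.Bundles using (CommutativeMonoid)
import Algebra.Properties.CommutativeMonoid.Sum as BigOp
open import Function using (_∘_; id; Injective)
open import Function.Bundles using (Equivalence)
open import Relation.Binary.PropositionalEquality
open import Relation.Nullary using (yes; no)
open import Relation.Nullary.Negation using (contradiction)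

τ : ∀ {k} → Fin (suc (suc k)) → Fin (suc (suc k))
τ {zero}  zero       = suc zero
τ {zero}  (suc zero) = zero
τ {suc k} zero       = zero
τ {suc k} (suc i)    = suc (τ i)

τ-involutive : ∀ {k} (i : Fin (suc (suc k))) → τ (τ i) ≡ i
τ-involutive {zero}  zero       = refl
τ-involutive {zero}  (suc zero) = refl
τ-involutive {suc k} zero       = refl
τ-involutive {suc k} (suc i)    = cong suc (τ-involutive i)

τ-fixes-low : ∀ {k} (i : Fin (suc (suc k))) → toℕ i < k → τ i ≡ i
τ-fixes-low {suc k} zero    _         = refl
τ-fixes-low {suc k} (suc i) (s≤s i<k) = cong suc (τ-fixes-low i i<k)

τ-keeps-high : ∀ {k} (i : Fin (suc (suc k))) → k ≤ toℕ i → k ≤ toℕ (τ i)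
τ-keeps-high {zero}  i       _         = z≤n
τ-keeps-high {suc k} (suc i) (s≤s k≤i) = s≤s (τ-keeps-high i k≤i)

τ-≡ᵇ : ∀ {k} (i j : Fin (suc (suc k))) → (toℕ (τ i) ≡ᵇ toℕ (τ j)) ≡ (toℕ i ≡ᵇ toℕ j)
τ-≡ᵇ {zero}  zero       zero       = refl
τ-≡ᵇ {zero}  zero       (suc zero) = refl
τ-≡ᵇ {zero}  (suc zero) zero       = refl
τ-≡ᵇ {zero}  (suc zero) (suc zero) = refl
τ-≡ᵇ {suc k} zero       zero       = refl
τ-≡ᵇ {suc k} zero       (suc j)    = refl
τ-≡ᵇ {suc k} (suc i)    zero       = refl
τ-≡ᵇ {suc k} (suc i)    (suc j)    = τ-≡ᵇ i j

swapLast : ∀ {A : Set} {k} → Vec A (suc (suc k)) → Vec A (suc (suc k))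
swapLast {k = zero}  (x ∷ y ∷ []) = y ∷ x ∷ []
swapLast {k = suc k} (x ∷ xs)     = x ∷ swapLast xs

lookup-swapLast : ∀ {A : Set} {k} (v : Vec A (suc (suc k))) i →
                  lookup (swapLast v) i ≡ lookup v (τ i)
lookup-swapLast {k = zero}  (x ∷ y ∷ []) zero       = refl
lookup-swapLast {k = zero}  (x ∷ y ∷ []) (suc zero) = refl
lookup-swapLast {k = suc k} (x ∷ xs)     zero       = refl
lookup-swapLast {k = suc k} (x ∷ xs)     (suc i)    = lookup-swapLast xs i

module _ {c ℓ} (M : CommutativeMonoid c ℓ) where
  open CommutativeMonoid M using (Carrier; _≈_)
  open BigOp M using (sum-permute) renaming (sum to ∑ᴹ)

  sum-τ : ∀ {k} (f : Fin (suc (suc k)) → Carrier) → ∑ᴹ f ≈ ∑ᴹ (f ∘ τ)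
  sum-τ f = sum-permute f (permutation τ τ τ-involutive τ-involutive)

module ∑ = BigOp +-0-commutativeMonoid
module ⋀ = BigOp ∧-commutativeMonoid

∑ : ∀ {m} → (Fin m → ℕ) → ℕ
∑ = ∑.sum

⋀ : ∀ {m} → (Fin m → Bool) → Bool
⋀ = ⋀.sum

bit : Bool → ℕ
bit b = if b then 1 else 0

count : ∀ {m} → (Fin m → Bool) → ℕ
count h = ∑ (bit ∘ h)

count-cong : ∀ {m} {g h : Fin m → Bool} → (∀ i → g i ≡ h i) → count g ≡ count h
count-cong g≗h = ∑.sum-cong-≗ (cong bit ∘ g≗h)

count-τ : ∀ {k} (h : Fin (suc (suc k)) → Bool) → count h ≡ count (h ∘ τ)
count-τ h = sum-τ +-0-commutativeMonoid (bit ∘ h)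

⋀-elim : ∀ {m} (h : Fin m → Bool) → T (⋀ h) → ∀ i → T (h i)
⋀-elim {suc m} h holds zero    = proj₁ (Equivalence.to T-∧ holds)
⋀-elim {suc m} h holds (suc i) = ⋀-elim (h ∘ suc) (proj₂ (Equivalence.to T-∧ holds)) i

foldr-tabulate : ∀ {A : Set} {m} (_∙_ : A → A → A) (e : A) (f : Fin m → A) →
                 List.foldr _∙_ e (List.tabulate f) ≡ Vector.foldr _∙_ e f
foldr-tabulate {m = zero}  _∙_ e f = refl
foldr-tabulate {m = suc m} _∙_ e f = cong (f zero ∙_) (foldr-tabulate _∙_ e (f ∘ suc))

sum-tabulate : ∀ {A : Set} {m} (f : A → ℕ) (h : Fin m → A) → sum (map f (List.tabulate h)) ≡ ∑ (f ∘ h)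
sum-tabulate f h = trans (cong sum (map-tabulate h f)) (foldr-tabulate _+_ 0 (f ∘ h))

all-allFin : ∀ {m} (h : Fin m → Bool) → all h (allFin m) ≡ ⋀ h
all-allFin h = trans (cong and (map-tabulate id h)) (foldr-tabulate _∧_ true h)

countB-sum : ∀ {A : Set} (p : A → Bool) xs → countB p xs ≡ sum (map (bit ∘ p) xs)
countB-sum p []       = refl
countB-sum p (x ∷ xs) with p x
... | true  = cong suc (countB-sum p xs)
... | false = countB-sum p xs

countB-allFin : ∀ {m} (h : Fin m → Bool) → countB h (allFin m) ≡ count h
countB-allFin h = trans (countB-sum h (allFin _)) (sum-tabulate (bit ∘ h) id)

keep : ∀ {A : Set} → (A → Bool) → List A → List A
keep p = filter (λ x → true ≟ p x)

countB-keep : ∀ {A : Set} (p g : A → Bool) xs → countB g (keep p xs) ≡ countB (λ x → p x ∧ g x) xs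
countB-keep p g []       = refl
countB-keep p g (x ∷ xs) with p x
... | false = countB-keep p g xs
... | true with g x
...   | true  = cong suc (countB-keep p g xs)
...   | false = countB-keep p g xs

countB-split : ∀ {A : Set} (q g : A → Bool) xs →
               countB g xs ≡ countB (λ x → q x ∧ g x) xs + countB (λ x → not (q x) ∧ g x) xs
countB-split q g []       = refl
countB-split q g (x ∷ xs) with q x | g x
... | true  | true  = cong suc (countB-split q g xs)
... | false | true  = trans (cong suc (countB-split q g xs)) (sym (+-suc _ _))
... | true  | false = countB-split q g xs
... | false | false = countB-split q g xs

countB-partition : ∀ {A : Set} (q g : A → Bool) xs →
                   countB g xs ≡ countB g (keep q xs) + countB g (keep (not ∘ q) xs)
countB-partition q g xs = trans (countB-split q g xs)
  (sym (cong₂ _+_ (countB-keep q g xs) (countB-keep (not ∘ q) g xs)))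

countB-cong : ∀ {A : Set} {p q : A → Bool} → (∀ x → p x ≡ q x) → ∀ xs → countB p xs ≡ countB q xs
countB-cong {p = p} {q} p≗q xs =
  trans (countB-sum p xs) (trans (cong sum (map-cong (cong bit ∘ p≗q) xs)) (sym (countB-sum q xs)))

twice-from-halves : ∀ {n} (q : Vec (Fin n) n → Bool) (X : List (Vec (Fin n) n)) →
  genPoly (keep q X) ≈P genPoly (keep (not ∘ q) X) → twice (genPoly (keep q X)) ≈P genPoly X
twice-from-halves q X halves a b = begin
  2 * half                                        ≡⟨ cong (half +_) (+-identityʳ half) ⟩
  half + half                                     ≡⟨ cong (half +_) (halves a b) ⟩
  half + genPoly (keep (not ∘ q) X) a b           ≡⟨ countB-partition q _ X ⟨
  genPoly X a b                                   ∎
  where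
  open ≡-Reasoning
  half : ℕ
  half = genPoly (keep q X) a b

sumWords : ∀ n m → (Vec (Fin n) m → ℕ) → ℕ
sumWords n m f = sum (map f (words n m))

sum-concatMap : ∀ {A B : Set} (f : B → ℕ) (g : A → List B) xs →
                sum (map f (concatMap g xs)) ≡ sum (map (λ x → sum (map f (g x))) xs)
sum-concatMap f g []       = refl
sum-concatMap f g (x ∷ xs) = begin
  sum (map f (g x List.++ concatMap g xs))             ≡⟨ cong sum (map-++ f (g x) _) ⟩
  sum (map f (g x) List.++ map f (concatMap g xs))     ≡⟨ sum-++ (map f (g x)) _ ⟩
  sum (map f (g x)) + sum (map f (concatMap g xs))     ≡⟨ cong (_ +_) (sum-concatMap f g xs) ⟩
  sum (map f (g x)) + sum (map (λ y → sum (map f (g y))) xs) ∎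
  where open ≡-Reasoning

sumWords-suc : ∀ n m (f : Vec (Fin n) (suc m) → ℕ) →
               sumWords n (suc m) f ≡ sumWords n m (λ w → ∑ (λ x → f (x ∷ w)))
sumWords-suc n m f = trans (sum-concatMap f _ (words n m))
  (cong sum (map-cong (λ w → trans (cong (sum ∘ map f) (map-tabulate id (_∷ w)))
                                   (sum-tabulate f (_∷ w)))
                      (words n m)))

sumWords-swapLast : ∀ n k (f : Vec (Fin n) (suc (suc k)) → ℕ) →
                    sumWords n (suc (suc k)) f ≡ sumWords n (suc (suc k)) (f ∘ swapLast)
sumWords-swapLast n zero f = begin
  sumWords n 2 f                              ≡⟨ sumWords-suc n 1 f ⟩
  sumWords n 1 (λ w → ∑ λ x → f (x ∷ w))      ≡⟨ sumWords-suc n 0 _ ⟩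
  ∑ (λ y → ∑ λ x → f (x ∷ y ∷ [])) + 0        ≡⟨ cong (_+ 0) (∑.∑-comm (λ y x → f (x ∷ y ∷ []))) ⟩
  ∑ (λ x → ∑ λ y → f (x ∷ y ∷ [])) + 0        ≡⟨ sumWords-suc n 0 _ ⟨
  sumWords n 1 (λ w → ∑ λ x → f (swapLast (x ∷ w)))  ≡⟨ sumWords-suc n 1 (f ∘ swapLast) ⟨
  sumWords n 2 (f ∘ swapLast)                 ∎
  where open ≡-Reasoning
sumWords-swapLast n (suc k) f = begin
  sumWords n (3 + k) f                                ≡⟨ sumWords-suc n (2 + k) f ⟩
  sumWords n (2 + k) (λ w → ∑ λ x → f (x ∷ w))        ≡⟨ sumWords-swapLast n k _ ⟩
  sumWords n (2 + k) (λ w → ∑ λ x → f (x ∷ swapLast w)) ≡⟨ sumWords-suc n (2 + k) (f ∘ swapLast) ⟨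
  sumWords n (3 + k) (f ∘ swapLast)                   ∎
  where open ≡-Reasoning

countB-words-swapLast : ∀ n k (p : Vec (Fin n) (suc (suc k)) → Bool) →
  countB p (words n (suc (suc k))) ≡ countB (p ∘ swapLast) (words n (suc (suc k)))
countB-words-swapLast n k p = begin
  countB p (words n (2 + k))                    ≡⟨ countB-sum p (words n (2 + k)) ⟩
  sumWords n (2 + k) (bit ∘ p)                  ≡⟨ sumWords-swapLast n k (bit ∘ p) ⟩
  sumWords n (2 + k) (bit ∘ p ∘ swapLast)       ≡⟨ countB-sum (p ∘ swapLast) (words n (2 + k)) ⟨
  countB (p ∘ swapLast) (words n (2 + k))       ∎
  where open ≡-Reasoning

inversions : ∀ {m n} → (Fin m → Fin n) → ℕ
inversions g = ∑ λ i → count λ j → (toℕ i <ᵇ toℕ j) ∧ (toℕ (g j) <ᵇ toℕ (g i))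

inv-inversions : ∀ {n} (π : Vec (Fin n) n) → inv π ≡ inversions (lookup π)
inv-inversions {n} π =
  trans (sum-tabulate (λ i → countB (inverted i) (allFin n)) id)
        (∑.sum-cong-≗ (λ i → countB-allFin (inverted i)))
  where
  inverted : Fin n → Fin n → Bool
  inverted i j = (toℕ i <ᵇ toℕ j) ∧ (toℕ (lookup π j) <ᵇ toℕ (lookup π i))

inversions-cong : ∀ {m n} {g h : Fin m → Fin n} → (∀ i → g i ≡ h i) → inversions g ≡ inversions h
inversions-cong g≗h = ∑.sum-cong-≗ λ i → count-cong λ j →
  cong₂ (λ a b → (toℕ i <ᵇ toℕ j) ∧ (toℕ a <ᵇ toℕ b)) (g≗h j) (g≗h i)

isEvenℕ-suc : ∀ m → isEvenℕ (suc m) ≡ not (isEvenℕ m)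
isEvenℕ-suc zero          = refl
isEvenℕ-suc (suc zero)    = refl
isEvenℕ-suc (suc (suc m)) = isEvenℕ-suc m

opposite-parity-+ : ∀ c {m m′} → isEvenℕ m′ ≡ not (isEvenℕ m) →
                    isEvenℕ (c + m′) ≡ not (isEvenℕ (c + m))
opposite-parity-+ zero    opposite = opposite
opposite-parity-+ (suc c) {m} {m′} opposite = begin
  isEvenℕ (suc (c + m′))       ≡⟨ isEvenℕ-suc (c + m′) ⟩
  not (isEvenℕ (c + m′))       ≡⟨ cong not (opposite-parity-+ c opposite) ⟩
  not (not (isEvenℕ (c + m)))  ≡⟨ cong not (isEvenℕ-suc (c + m)) ⟨
  not (isEvenℕ (suc (c + m)))  ∎
  where open ≡-Reasoning

<ᵇ-flip : ∀ x y → x ≢ y → (y <ᵇ x) ≡ not (x <ᵇ y)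
<ᵇ-flip zero    zero    x≢y = contradiction refl x≢y
<ᵇ-flip zero    (suc y) _   = refl
<ᵇ-flip (suc x) zero    _   = refl
<ᵇ-flip (suc x) (suc y) x≢y = <ᵇ-flip x y (x≢y ∘ cong suc)

-- By induction on the length:
-- the inversions involving the first index are counted over a set that τ
-- merely permutes, and for length two the single pair is inverted or not.
inversions-τ : ∀ {k n} (g : Fin (suc (suc k)) → Fin n) → Injective _≡_ _≡_ g →
               isEvenℕ (inversions (g ∘ τ)) ≡ not (isEvenℕ (inversions g))
inversions-τ {zero} g g-inj
  rewrite <ᵇ-flip (toℕ (g zero)) (toℕ (g (suc zero))) (0≢1+n ∘ g-inj ∘ toℕ-injective)
  with toℕ (g zero) <ᵇ toℕ (g (suc zero))
... | true  = refl
... | false = refl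
-- For length ≥ 3, inversions g unfolds definitionally to the count of
-- indices j > 0 below the first one, plus inversions (g ∘ suc).
inversions-τ {suc k} g g-inj = begin
  isEvenℕ (count (λ j → below (Fin.suc (τ j))) + inversions (g ∘ Fin.suc ∘ τ))
    ≡⟨ cong (λ c → isEvenℕ (c + inversions (g ∘ Fin.suc ∘ τ))) (count-τ (below ∘ Fin.suc)) ⟨
  isEvenℕ (count (below ∘ Fin.suc) + inversions (g ∘ Fin.suc ∘ τ))
    ≡⟨ opposite-parity-+ (count (below ∘ Fin.suc)) (inversions-τ (g ∘ Fin.suc) (Fin-suc-injective ∘ g-inj)) ⟩
  not (isEvenℕ (count (below ∘ Fin.suc) + inversions (g ∘ Fin.suc)))
    ∎
  where
  open ≡-Reasoning
  below : Fin (suc (suc (suc k))) → Bool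
  below j = toℕ (g j) <ᵇ toℕ (g zero)

∨-not-mp : ∀ a {b} → T (a ∨ not b) → T b → T a
∨-not-mp true          _  _ = tt
∨-not-mp false {true}  () _
∨-not-mp false {false} _  ()

not-∨-mp : ∀ {a} b → T (not a ∨ b) → T a → T b
not-∨-mp {true}  b holds _  = holds
not-∨-mp {false} b _     ()

∧-guarded : ∀ p m {x y : Bool} → (T p → T m → x ≡ y) → p ∧ (m ∧ x) ≡ p ∧ (m ∧ y)
∧-guarded true  true  x≡y = x≡y tt tt
∧-guarded true  false _   = refl
∧-guarded false _     _   = refl

<ᵇ-false : ∀ m n → n ≤ m → (m <ᵇ n) ≡ false
<ᵇ-false zero    zero    z≤n       = refl
<ᵇ-false (suc m) zero    z≤n       = refl
<ᵇ-false (suc m) (suc n) (s≤s n≤m) = <ᵇ-false m n n≤m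

injectiveᵇ : ∀ {m n} → (Fin m → Fin n) → Bool
injectiveᵇ g = ⋀ λ i → ⋀ λ j → (toℕ i ≡ᵇ toℕ j) ∨ not (toℕ (g i) ≡ᵇ toℕ (g j))

isPerm-injectiveᵇ : ∀ {n} (π : Vec (Fin n) n) → isPerm π ≡ injectiveᵇ (lookup π)
isPerm-injectiveᵇ {n} π =
  trans (all-allFin (λ i → all (distinct i) (allFin n)))
        (⋀.sum-cong-≗ (λ i → all-allFin (distinct i)))
  where
  distinct : Fin n → Fin n → Bool
  distinct i j = (toℕ i ≡ᵇ toℕ j) ∨ not (toℕ (lookup π i) ≡ᵇ toℕ (lookup π j))

injectiveᵇ-cong : ∀ {m n} {g h : Fin m → Fin n} → (∀ i → g i ≡ h i) → injectiveᵇ g ≡ injectiveᵇ h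
injectiveᵇ-cong g≗h = ⋀.sum-cong-≗ λ i → ⋀.sum-cong-≗ λ j →
  cong₂ (λ a b → _ ∨ not (toℕ a ≡ᵇ toℕ b)) (g≗h i) (g≗h j)

injectiveᵇ-sound : ∀ {m n} (g : Fin m → Fin n) → T (injectiveᵇ g) → Injective _≡_ _≡_ g
injectiveᵇ-sound g holds {i} {j} gi≡gj = toℕ-injective (≡ᵇ⇒≡ _ _
  (∨-not-mp _ (⋀-elim _ (⋀-elim _ holds i) j) (≡⇒≡ᵇ _ _ (cong toℕ gi≡gj))))

injectiveᵇ-τ : ∀ {k n} (g : Fin (suc (suc k)) → Fin n) → injectiveᵇ (g ∘ τ) ≡ injectiveᵇ g
injectiveᵇ-τ {k} g = begin
  injectiveᵇ (g ∘ τ)                 ≡⟨ ⋀.sum-cong-≗ (λ i → ⋀.sum-cong-≗ (λ j →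
                                          cong (_∨ excluded i j) (sym (τ-≡ᵇ i j)))) ⟩
  ⋀ (λ i → ⋀ (λ j → test (τ i) (τ j))) ≡⟨ ⋀.sum-cong-≗ (λ i → sum-τ ∧-commutativeMonoid (test (τ i))) ⟨
  ⋀ (λ i → ⋀ (test (τ i)))             ≡⟨ sum-τ ∧-commutativeMonoid (⋀ ∘ test) ⟨
  injectiveᵇ g                       ∎
  where
  open ≡-Reasoning
  excluded : Fin (suc (suc k)) → Fin (suc (suc k)) → Bool
  excluded i j = not (toℕ (g (τ i)) ≡ᵇ toℕ (g (τ j)))
  test : Fin (suc (suc k)) → Fin (suc (suc k)) → Bool
  test i j = (toℕ i ≡ᵇ toℕ j) ∨ not (toℕ (g i) ≡ᵇ toℕ (g j))

isPerm-injective : ∀ {n} (π : Vec (Fin n) n) → T (isPerm π) → Injective _≡_ _≡_ (lookup π)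
isPerm-injective π perm = injectiveᵇ-sound (lookup π) (subst T (isPerm-injectiveᵇ π) perm)

isPerm-swapLast : ∀ {k} (π : Vec (Fin (suc (suc k))) (suc (suc k))) → isPerm (swapLast π) ≡ isPerm π
isPerm-swapLast π = begin
  isPerm (swapLast π)             ≡⟨ isPerm-injectiveᵇ (swapLast π) ⟩
  injectiveᵇ (lookup (swapLast π)) ≡⟨ injectiveᵇ-cong (lookup-swapLast π) ⟩
  injectiveᵇ (lookup π ∘ τ)        ≡⟨ injectiveᵇ-τ (lookup π) ⟩
  injectiveᵇ (lookup π)            ≡⟨ isPerm-injectiveᵇ π ⟨
  isPerm π                         ∎
  where open ≡-Reasoning

maxTest : ∀ {n} → ℕ → Vec (Fin n) n → Fin n → Bool
maxTest {n} r π i = not (suc (toℕ i) ≡ᵇ r) ∨ (suc (toℕ (lookup π i)) ≡ᵇ n)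

hasMaxAt-sound : ∀ {n} r (π : Vec (Fin n) n) → T (hasMaxAt r π) →
                 ∀ i → suc (toℕ i) ≡ r → suc (toℕ (lookup π i)) ≡ n
hasMaxAt-sound {n} r π holds i at-r = ≡ᵇ⇒≡ _ _ (not-∨-mp _ test-holds (≡⇒≡ᵇ _ _ at-r))
  where
  test-holds : T (maxTest r π i)
  test-holds = ⋀-elim (maxTest r π)
    (subst T (all-allFin (maxTest r π)) (proj₁ (Equivalence.to T-∧ holds))) i

-- Positions r ≤ k are not moved by τ, so the swap keeps the maximum at r.
hasMaxAt-swapLast : ∀ {k} r → r ≤ k → (π : Vec (Fin (suc (suc k))) (suc (suc k))) →
                    hasMaxAt r (swapLast π) ≡ hasMaxAt r π
hasMaxAt-swapLast {k} r r≤k π = cong (λ b → b ∧ ((1 <ᵇ suc r) ∧ (r <ᵇ suc (suc (suc k))))) (begin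
  all (maxTest r (swapLast π)) (allFin _) ≡⟨ all-allFin (maxTest r (swapLast π)) ⟩
  ⋀ (maxTest r (swapLast π))              ≡⟨ ⋀.sum-cong-≗ maxTest-swapLast ⟩
  ⋀ (maxTest r π)                         ≡⟨ all-allFin (maxTest r π) ⟨
  all (maxTest r π) (allFin _)            ∎)
  where
  open ≡-Reasoning
  maxTest-swapLast : ∀ i → maxTest r (swapLast π) i ≡ maxTest r π i
  maxTest-swapLast i with suc (toℕ i) ≡ᵇ r in at-r
  ... | false = refl
  ... | true  = cong (λ v → suc (toℕ v) ≡ᵇ suc (suc k))
    (trans (lookup-swapLast π i) (cong (lookup π) (τ-fixes-low i i<k)))
    where
    i<k : toℕ i < k
    i<k = ≤-trans (≤-reflexive (≡ᵇ⇒≡ _ r (Equivalence.from T-≡ at-r))) r≤k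

last-values-small : ∀ {k} (g : Fin (suc (suc k)) → Fin (suc (suc k))) → Injective _≡_ _≡_ g →
                    (p : Fin (suc (suc k))) → toℕ p < k → toℕ (g p) ≡ suc k →
                    ∀ i → k ≤ toℕ i → toℕ (g i) ≤ k
last-values-small {k} g g-inj p p<k gp-max i k≤i =
  s≤s⁻¹ (≤∧≢⇒< (s≤s⁻¹ (toℕ<n (g i))) gi≢max)
  where
  gi≢max : toℕ (g i) ≢ suc k
  gi≢max gi-max = <⇒≱ (≤-trans p<k k≤i)
    (≤-reflexive (cong toℕ (g-inj (toℕ-injective (trans gi-max (sym gp-max))))))

-- If the values at the last two positions are ≤ k, neither position is an
-- excedance, so moving the position by τ does not change the excedance test.
excedance-τ : ∀ {k} (g : Fin (suc (suc k)) → Fin (suc (suc k))) →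
              (∀ i → k ≤ toℕ i → toℕ (g i) ≤ k) →
              ∀ i → (toℕ (τ i) <ᵇ toℕ (g i)) ≡ (toℕ i <ᵇ toℕ (g i))
excedance-τ {k} g small i with toℕ i <? k
... | yes i<k = cong (λ j → toℕ j <ᵇ toℕ (g i)) (τ-fixes-low i i<k)
... | no  i≮k = trans (no-excedance (τ-keeps-high i k≤i)) (sym (no-excedance k≤i))
  where
  k≤i : k ≤ toℕ i
  k≤i = ≮⇒≥ i≮k
  no-excedance : ∀ {j} → k ≤ j → (j <ᵇ toℕ (g i)) ≡ false
  no-excedance k≤j = <ᵇ-false _ _ (≤-trans (small i k≤i) k≤j)

-- Hence every statistic f (π_i > i) counted over positions (exc for f = id,
-- nexc for f = not) is invariant under the swap.
excedance-stat-swapLast : ∀ {k} (f : Bool → Bool) (π : Vec (Fin (suc (suc k))) (suc (suc k))) →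
  (∀ i → k ≤ toℕ i → toℕ (lookup π i) ≤ k) →
  countB (λ i → f (toℕ i <ᵇ toℕ (lookup (swapLast π) i))) (allFin _) ≡
  countB (λ i → f (toℕ i <ᵇ toℕ (lookup π i))) (allFin _)
excedance-stat-swapLast {k} f π small = begin
  countB (λ i → f (toℕ i <ᵇ toℕ (lookup (swapLast π) i))) (allFin _)
    ≡⟨ countB-allFin (λ i → f (toℕ i <ᵇ toℕ (lookup (swapLast π) i))) ⟩
  count (λ i → f (toℕ i <ᵇ toℕ (lookup (swapLast π) i)))
    ≡⟨ count-cong (λ i → cong (λ v → f (toℕ i <ᵇ toℕ v)) (lookup-swapLast π i)) ⟩
  count (λ i → f (toℕ i <ᵇ toℕ (g (τ i))))
    ≡⟨ count-τ (λ i → f (toℕ i <ᵇ toℕ (g (τ i)))) ⟩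
  count (λ i → f (toℕ (τ i) <ᵇ toℕ (g (τ (τ i)))))
    ≡⟨ count-cong (λ i → cong (λ j → f (toℕ (τ i) <ᵇ toℕ (g j))) (τ-involutive i)) ⟩
  count (λ i → f (toℕ (τ i) <ᵇ toℕ (g i)))
    ≡⟨ count-cong (λ i → cong f (excedance-τ g small i)) ⟩
  count (λ i → f (toℕ i <ᵇ toℕ (g i)))
    ≡⟨ countB-allFin (λ i → f (toℕ i <ᵇ toℕ (g i))) ⟨
  countB (λ i → f (toℕ i <ᵇ toℕ (lookup π i))) (allFin _)
    ∎
  where
  open ≡-Reasoning
  g : Fin (suc (suc k)) → Fin (suc (suc k))
  g = lookup π

isEven-swapLast : ∀ {k} (π : Vec (Fin (suc (suc k))) (suc (suc k))) → Injective _≡_ _≡_ (lookup π) →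
                  isEven (swapLast π) ≡ not (isEven π)
isEven-swapLast π π-inj = begin
  isEvenℕ (inv (swapLast π))                  ≡⟨ cong isEvenℕ (inv-inversions (swapLast π)) ⟩
  isEvenℕ (inversions (lookup (swapLast π)))  ≡⟨ cong isEvenℕ (inversions-cong (lookup-swapLast π)) ⟩
  isEvenℕ (inversions (lookup π ∘ τ))         ≡⟨ inversions-τ (lookup π) π-inj ⟩
  not (isEvenℕ (inversions (lookup π)))       ≡⟨ cong (not ∘ isEvenℕ) (inv-inversions π) ⟨
  not (isEvenℕ (inv π))                       ∎
  where open ≡-Reasoning

coefficientTest : ∀ {n} → ℕ → ℕ → Vec (Fin n) n → Bool
coefficientTest a b π = (exc π ≡ᵇ a) ∧ ((nexc π ∸ 1) ≡ᵇ b)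

module Involution (k r′ : ℕ) (r≤k : suc r′ ≤ k) where

  N r : ℕ
  N = suc (suc k)
  r = suc r′

  selected : (Vec (Fin N) N → Bool) → ℕ → ℕ → Vec (Fin N) N → Bool
  selected q a b π = isPerm π ∧ (hasMaxAt r π ∧ (q π ∧ coefficientTest a b π))

  coefficient-as-count : ∀ q a b →
    genPoly (keep q (Sr N r)) a b ≡ countB (selected q a b) (words N N)
  coefficient-as-count q a b =
    trans (countB-keep q (coefficientTest a b) (Sr N r))
    (trans (countB-keep (hasMaxAt r) (λ π → q π ∧ coefficientTest a b π) (Sym N))
           (countB-keep isPerm (λ π → hasMaxAt r π ∧ (q π ∧ coefficientTest a b π)) (words N N)))

  -- For π ∈ 𝔖ₙʳ the maximum sits at the position r′ < k, so the values at the
  -- last two positions are ≤ k.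
  last-values-of-Sr : ∀ π → T (isPerm π) → T (hasMaxAt r π) →
                      ∀ i → k ≤ toℕ i → toℕ (lookup π i) ≤ k
  last-values-of-Sr π perm max =
    last-values-small (lookup π) (isPerm-injective π perm)
      p p<k (suc-injective (hasMaxAt-sound r π max p (cong suc (toℕ-fromℕ< r′<N))))
    where
    r′<N : r′ < N
    r′<N = ≤-trans r≤k (≤-trans (n≤1+n k) (n≤1+n (suc k)))
    p : Fin N
    p = fromℕ< r′<N
    p<k : toℕ p < k
    p<k = subst (_< k) (sym (toℕ-fromℕ< r′<N)) r≤k

  swap-on-Sr : ∀ a b π → T (isPerm π) → T (hasMaxAt r π) →
    isEven (swapLast π) ∧ coefficientTest a b (swapLast π) ≡ not (isEven π) ∧ coefficientTest a b π
  swap-on-Sr a b π perm max =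
    cong₂ _∧_ (isEven-swapLast π (isPerm-injective π perm))
              (cong₂ (λ e ne → (e ≡ᵇ a) ∧ ((ne ∸ 1) ≡ᵇ b))
                     (excedance-stat-swapLast id π small) (excedance-stat-swapLast not π small))
    where
    small : ∀ i → k ≤ toℕ i → toℕ (lookup π i) ≤ k
    small = last-values-of-Sr π perm max

  swap-exchanges-parity : ∀ a b π → selected isEven a b (swapLast π) ≡ selected (not ∘ isEven) a b π
  swap-exchanges-parity a b π = begin
    selected isEven a b (swapLast π)
      ≡⟨ cong₂ (λ p m → p ∧ (m ∧ statistics)) (isPerm-swapLast π) (hasMaxAt-swapLast r r≤k π) ⟩
    isPerm π ∧ (hasMaxAt r π ∧ statistics)
      ≡⟨ ∧-guarded (isPerm π) (hasMaxAt r π) (swap-on-Sr a b π) ⟩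
    selected (not ∘ isEven) a b π
      ∎
    where
    open ≡-Reasoning
    statistics : Bool
    statistics = isEven (swapLast π) ∧ coefficientTest a b (swapLast π)

  even-odd-balance : genPoly (Ar N r) ≈P genPoly (SrMinusAr N r)
  even-odd-balance a b = begin
    genPoly (Ar N r) a b                              ≡⟨ coefficient-as-count isEven a b ⟩
    countB (selected isEven a b) (words N N)          ≡⟨ countB-words-swapLast N k (selected isEven a b) ⟩
    countB (selected isEven a b ∘ swapLast) (words N N) ≡⟨ countB-cong (swap-exchanges-parity a b) (words N N) ⟩
    countB (selected (not ∘ isEven) a b) (words N N)  ≡⟨ coefficient-as-count (not ∘ isEven) a b ⟨
    genPoly (SrMinusAr N r) a b                       ∎
    where open ≡-Reasoning

lemma11 : (n r : ℕ) → 1 ≤ r → r ≤ n ∸ 2 →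
    (genPoly (Ar n r) ≈P genPoly (SrMinusAr n r))
      × (twice (genPoly (Ar n r)) ≈P genPoly (Sr n r))
lemma11 (suc (suc k)) (suc r′) _ r≤k =
  balance , twice-from-halves isEven (Sr (suc (suc k)) (suc r′)) balance
  where
  balance : genPoly (Ar (suc (suc k)) (suc r′)) ≈P genPoly (SrMinusAr (suc (suc k)) (suc r′))
  balance = Involution.even-odd-balance k r′ r≤k
lemma11 zero          (suc r′) _ ()
lemma11 (suc zero)    (suc r′) _ ()
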